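{- If $\Phi\vdash\psi$ in the natural deduction system for $\mathsf{BSML}^{\oslash}$, then $\Phi\vDash\psi$.
   Context: Formulas of $\mathsf{BSML}^{\oslash}$: $\phi ::= p \mid \neg\phi \mid \phi\wedge\phi \mid \phi\vee\phi \mid \Diamond\phi \mid \mathrm{NE}\mid\oslash\phi$; $\mathsf{ML}$ is the fragment without $\mathrm{NE}$ and $\oslash$; $\Box\phi:=\neg\Diamond\neg\phi$, $\bot:=p\wedge\neg p$, $\bot\!\!\!\bot:=\bot\wedge\mathrm{NE}$. Semantics on Kripke models $M=(W,R,V)$ and states $s\subseteq W$ ($R[w]=\{v\mid wRv\}$), support $\vDash$ / anti-support $\mathrel{=\!\!\mid}$: $s\vDash p$ iff $s\subseteq V(p)$; $s\mathrel{=\!\!\mid} p$ iff $s\cap V(p)=\emptyset$; $s\vDash\mathrm{NE}$ iff $s\neq\emptyset$; $s\mathrel{=\!\!\mid}\mathrm{NE}$ iff $s=\emptyset$; $s\vDash\neg\phi$ iff $s\mathrel{=\!\!\mid}\phi$; $s\mathrel{=\!\!\mid}\neg\phi$ iff $s\vDash\phi$; $s\vDash\phi\wedge\psi$ iff both supported; $s\mathrel{=\!\!\mid}\phi\wedge\psi$ iff $s=t\cup u$, $t\mathrel{=\!\!\mid}\phi$, $u\mathrel{=\!\!\mid}\psi$; $s\vDash\phi\vee\psi$ iff $s=t\cup u$, $t\vDash\phi$, $u\vDash\psi$; $s\mathrel{=\!\!\mid}\phi\vee\psi$ iff both anti-supported; $s\vDash\Diamond\phi$ iff every $w\in s$ has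 nonempty $t\subseteq R[w]$ with $t\vDash\phi$; $s\mathrel{=\!\!\mid}\Diamond\phi$ iff $R[w]\mathrel{=\!\!\mid}\phi$ for all $w\in s$; $s\vDash\oslash\phi$ iff $s\vDash\phi$ or $s=\emptyset$; $s\mathrel{=\!\!\mid}\oslash\phi$ iff $s\mathrel{=\!\!\mid}\phi$. $\Phi\vDash\psi$: every $M,s$ supporting all of $\Phi$ supports $\psi$. An occurrence $[\psi]$ in $\phi$ is distributive if it is not in the scope of any $\neg$ or $\Diamond$ in $\phi$ (counting those inside $\Box=\neg\Diamond\neg$). The natural deduction system (metavariables $\alpha,\beta$ range over $\mathsf{ML}$ only; "$\dashv\vdash$" means both directions are rules; no uniform substitution) has rules: $\wedge$I, $\wedge$E (standard); $\neg$I: from a derivation of $\bot$ from $[\alpha]$ infer $\neg\alpha$, if undischarged assumptions contain no $\mathrm{NE}$; $\neg$E: $\alpha,\neg\alpha\vdash\beta$; $\neg\neg\phi\dashv\vdash\phi$; $\neg(\phi\wedge\psi)\dashv\vdash\neg\phi\vee\neg\psi$; $\neg(\phi\vee\psi)\dashv\vdash\neg\phi\wedge\neg\psi$; $\neg\mathrm{NE}\dashv\vdash\bot$; $\vee$I: $\phi\vdash\phi\vee\psi$ if $\psi$ contains no $\mathrm{NE}$; $\phi\vdash\phi\vee\phi$; $\phi\vee\psi\vdash\psi\vee\phi$; $\vee$E: from $\phi\vee\psi$ and derivations of $\chi$ from $[\phi]$ and from $[\psi]$ infer $\chi$, if the undischarged assumptions of those derivations contain no $\mathrm{NE}$; $\vee$Mon: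 from $\phi\vee\psi$ and a derivation of $\chi$ from $[\psi]$ (other undischarged assumptions $\mathrm{NE}$-free) infer $\phi\vee\chi$; $\bot\vee\phi\vdash\phi$; $\bot\!\!\!\bot\vee\phi\vdash\psi$; $\Diamond$Mon: from a derivation of $\psi$ from $[\phi]$ with no other undischarged assumptions and $\Diamond\phi$ infer $\Diamond\psi$; $\Box$Mon: from a derivation of $\psi$ from $[\phi_1],\dots,[\phi_n]$ with no other undischarged assumptions and $\Box\phi_1,\dots,\Box\phi_n$ infer $\Box\psi$; $\neg\Diamond\phi\dashv\vdash\Box\neg\phi$; $\Diamond(\phi\vee(\psi\wedge\mathrm{NE}))\vdash\Diamond\psi$; $\Diamond\phi,\Diamond\psi\vdash\Diamond(\phi\vee\psi)$; $\Box(\phi\wedge\mathrm{NE})\vdash\Diamond\phi$; $\Box\phi,\Diamond\psi\vdash\Box(\phi\vee\psi)$; $\vdash\oslash\mathrm{NE}$; $\bot\vdash\oslash\phi$; $\phi\vdash\oslash\phi$; $\oslash$E: from $\phi$, a derivation of $\chi$ from $[\phi[\psi/\oslash\psi]]$ and a derivation of $\chi$ from $[\phi[\bot/\oslash\psi]]$ infer $\chi$; $\neg\oslash\phi\dashv\vdash\neg\phi$; $\Diamond\phi\vdash\Diamond\phi[\psi/\oslash\psi]\vee\Diamond\phi[\bot/\oslash\psi]$; $\Box\phi\vdash\Box\phi[\psi/\oslash\psi]\vee\Box\phi[\bot/\oslash\psi]$; where in the last three non-symmetric $\oslash$-rules the replaced occurrence $[\oslash\psi]$ is distributive in $\phi$.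 -}

module Defs where

open import Level using (Level; Lift; 0ℓ) renaming (suc to lsuc)
open import Data.Nat using (ℕ)
open import Data.Empty using (⊥)
open import Data.Unit using (⊤)
open import Data.Product using (Σ; ∃; _×_; _,_)
open import Data.Sum using (_⊎_)
open import Data.List using (List; []; _∷_; _++_)
open import Data.List.Membership.Propositional using (_∈_)
open import Data.List.Relation.Binary.Subset.Propositional using (_⊆_)
open import Data.List.Relation.Unary.All using (All)
open import Relation.Nullary using (¬_)
open import Function.Bundles using (_⇔_)

infixr 6 _∧ᶠ_
infixr 5 _∨ᶠ_

data Fm : Set where
  var  : ℕ → Fm
  ¬ᶠ_  : Fm → Fm
  _∧ᶠ_ : Fm → Fm → Fm
  _∨ᶠ_ : Fm → Fm → Fm
  ◇_   : Fm → Fm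
  NE   : Fm
  ⊘_   : Fm → Fm

□_ : Fm → Fm
□ φ = ¬ᶠ (◇ (¬ᶠ φ))

⊥ᶠ : Fm
⊥ᶠ = var 0 ∧ᶠ ¬ᶠ var 0

⊥⊥ : Fm
⊥⊥ = ⊥ᶠ ∧ᶠ NE

data ML : Fm → Set where
  var : ∀ n → ML (var n)
  neg : ∀ {φ} → ML φ → ML (¬ᶠ φ)
  and : ∀ {φ ψ} → ML φ → ML ψ → ML (φ ∧ᶠ ψ)
  or  : ∀ {φ ψ} → ML φ → ML ψ → ML (φ ∨ᶠ ψ)
  dia : ∀ {φ} → ML φ → ML (◇ φ)

NEfree : Fm → Set
NEfree (var _)  = ⊤
NEfree (¬ᶠ φ)   = NEfree φ
NEfree (φ ∧ᶠ ψ) = NEfree φ × NEfree ψ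
NEfree (φ ∨ᶠ ψ) = NEfree φ × NEfree ψ
NEfree (◇ φ)    = NEfree φ
NEfree NE       = ⊥
NEfree (⊘ φ)    = NEfree φ

-- Distributive one-hole contexts: the hole is not in the scope of
-- any ¬ or ◇ (hence also not of any □ = ¬◇¬).

data DCtx : Set where
  hole : DCtx
  _∧ₗ_ : DCtx → Fm → DCtx
  _∧ᵣ_ : Fm → DCtx → DCtx
  _∨ₗ_ : DCtx → Fm → DCtx
  _∨ᵣ_ : Fm → DCtx → DCtx
  ⊘c   : DCtx → DCtx

plug : DCtx → Fm → Fm
plug hole χ     = χ
plug (C ∧ₗ ψ) χ = plug C χ ∧ᶠ ψ
plug (φ ∧ᵣ C) χ = φ ∧ᶠ plug C χ
plug (C ∨ₗ ψ) χ = plug C χ ∨ᶠ ψ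
plug (φ ∨ᵣ C) χ = φ ∨ᶠ plug C χ
plug (⊘c C) χ   = ⊘ plug C χ

-- So for φ = plug C (⊘ψ):  φ[ψ/⊘ψ] = plug C ψ  and  φ[⊥/⊘ψ] = plug C ⊥ᶠ.

-- Natural deduction, presented as sequents Γ ⊢ φ, where Γ lists (a
-- superset of) the undischarged assumptions.

infix 3 _⊢_

data _⊢_ : List Fm → Fm → Set where
  ass    : ∀ {φ} → (φ ∷ []) ⊢ φ
  weaken : ∀ {Γ Δ φ} → Γ ⊆ Δ → Γ ⊢ φ → Δ ⊢ φ
  ∧I  : ∀ {Γ Δ φ ψ} → Γ ⊢ φ → Δ ⊢ ψ → Γ ++ Δ ⊢ φ ∧ᶠ ψ
  ∧E₁ : ∀ {Γ φ ψ} → Γ ⊢ φ ∧ᶠ ψ → Γ ⊢ φ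
  ∧E₂ : ∀ {Γ φ ψ} → Γ ⊢ φ ∧ᶠ ψ → Γ ⊢ ψ
  ¬I  : ∀ {Γ α} → ML α → All NEfree Γ → α ∷ Γ ⊢ ⊥ᶠ → Γ ⊢ ¬ᶠ α
  ¬E  : ∀ {Γ Δ α β} → ML α → ML β → Γ ⊢ α → Δ ⊢ ¬ᶠ α → Γ ++ Δ ⊢ β
  ¬¬E : ∀ {Γ φ} → Γ ⊢ ¬ᶠ ¬ᶠ φ → Γ ⊢ φ
  ¬¬I : ∀ {Γ φ} → Γ ⊢ φ → Γ ⊢ ¬ᶠ ¬ᶠ φ
  ¬∧E : ∀ {Γ φ ψ} → Γ ⊢ ¬ᶠ (φ ∧ᶠ ψ) → Γ ⊢ ¬ᶠ φ ∨ᶠ ¬ᶠ ψ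
  ¬∧I : ∀ {Γ φ ψ} → Γ ⊢ ¬ᶠ φ ∨ᶠ ¬ᶠ ψ → Γ ⊢ ¬ᶠ (φ ∧ᶠ ψ)
  ¬∨E : ∀ {Γ φ ψ} → Γ ⊢ ¬ᶠ (φ ∨ᶠ ψ) → Γ ⊢ ¬ᶠ φ ∧ᶠ ¬ᶠ ψ
  ¬∨I : ∀ {Γ φ ψ} → Γ ⊢ ¬ᶠ φ ∧ᶠ ¬ᶠ ψ → Γ ⊢ ¬ᶠ (φ ∨ᶠ ψ)
  ¬NEE : ∀ {Γ} → Γ ⊢ ¬ᶠ NE → Γ ⊢ ⊥ᶠ
  ¬NEI : ∀ {Γ} → Γ ⊢ ⊥ᶠ → Γ ⊢ ¬ᶠ NE
  ∨I    : ∀ {Γ φ ψ} → NEfree ψ → Γ ⊢ φ → Γ ⊢ φ ∨ᶠ ψ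
  ∨dup  : ∀ {Γ φ} → Γ ⊢ φ → Γ ⊢ φ ∨ᶠ φ
  ∨comm : ∀ {Γ φ ψ} → Γ ⊢ φ ∨ᶠ ψ → Γ ⊢ ψ ∨ᶠ φ
  ∨E    : ∀ {Γ Δ φ ψ χ} → All NEfree Δ →
          Γ ⊢ φ ∨ᶠ ψ → φ ∷ Δ ⊢ χ → ψ ∷ Δ ⊢ χ → Γ ++ Δ ⊢ χ
  ∨Mon  : ∀ {Γ Δ φ ψ χ} → All NEfree Δ →
          Γ ⊢ φ ∨ᶠ ψ → ψ ∷ Δ ⊢ χ → Γ ++ Δ ⊢ φ ∨ᶠ χ
  ⊥∨E   : ∀ {Γ φ} → Γ ⊢ ⊥ᶠ ∨ᶠ φ → Γ ⊢ φ
  ⊥⊥∨E  : ∀ {Γ φ ψ} → Γ ⊢ ⊥⊥ ∨ᶠ φ → Γ ⊢ ψ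
  ◇Mon  : ∀ {Γ φ ψ} → (φ ∷ []) ⊢ ψ → Γ ⊢ ◇ φ → Γ ⊢ ◇ ψ
  □Mon  : ∀ {Γ ψ} (Φs : List Fm) → Φs ⊢ ψ →
          All (λ φ → Γ ⊢ □ φ) Φs → Γ ⊢ □ ψ
  ¬◇E   : ∀ {Γ φ} → Γ ⊢ ¬ᶠ ◇ φ → Γ ⊢ □ (¬ᶠ φ)
  ¬◇I   : ∀ {Γ φ} → Γ ⊢ □ (¬ᶠ φ) → Γ ⊢ ¬ᶠ ◇ φ
  ◇NE   : ∀ {Γ φ ψ} → Γ ⊢ ◇ (φ ∨ᶠ (ψ ∧ᶠ NE)) → Γ ⊢ ◇ ψ
  ◇∨    : ∀ {Γ Δ φ ψ} → Γ ⊢ ◇ φ → Δ ⊢ ◇ ψ → Γ ++ Δ ⊢ ◇ (φ ∨ᶠ ψ)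
  □NE   : ∀ {Γ φ} → Γ ⊢ □ (φ ∧ᶠ NE) → Γ ⊢ ◇ φ
  □◇∨   : ∀ {Γ Δ φ ψ} → Γ ⊢ □ φ → Δ ⊢ ◇ ψ → Γ ++ Δ ⊢ □ (φ ∨ᶠ ψ)
  ⊘NE   : [] ⊢ ⊘ NE
  ⊥⊘    : ∀ {Γ φ} → Γ ⊢ ⊥ᶠ → Γ ⊢ ⊘ φ
  ⊘I    : ∀ {Γ φ} → Γ ⊢ φ → Γ ⊢ ⊘ φ
  ⊘E    : ∀ {Γ Δ χ} (C : DCtx) (ψ : Fm) →
          Γ ⊢ plug C (⊘ ψ) → plug C ψ ∷ Δ ⊢ χ → plug C ⊥ᶠ ∷ Δ ⊢ χ →
          Γ ++ Δ ⊢ χ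
  ¬⊘E   : ∀ {Γ φ} → Γ ⊢ ¬ᶠ ⊘ φ → Γ ⊢ ¬ᶠ φ
  ¬⊘I   : ∀ {Γ φ} → Γ ⊢ ¬ᶠ φ → Γ ⊢ ¬ᶠ ⊘ φ
  ◇⊘    : ∀ {Γ} (C : DCtx) (ψ : Fm) → Γ ⊢ ◇ plug C (⊘ ψ) →
          Γ ⊢ ◇ plug C ψ ∨ᶠ ◇ plug C ⊥ᶠ
  □⊘    : ∀ {Γ} (C : DCtx) (ψ : Fm) → Γ ⊢ □ plug C (⊘ ψ) →
          Γ ⊢ □ plug C ψ ∨ᶠ □ plug C ⊥ᶠ

_⊢ˢ_ : (Fm → Set) → Fm → Set
Φ ⊢ˢ ψ = Σ (List Fm) λ Γ → (∀ φ → φ ∈ Γ → Φ φ) × (Γ ⊢ ψ)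

record Model : Set₁ where
  field
    W : Set
    R : W → W → Set
    V : ℕ → W → Set

open Model public

State : Model → Set₁
State M = W M → Set

module _ (M : Model) where

  IsUnion : State M → State M → State M → Set
  IsUnion s t u = ∀ w → s w ⇔ (t w ⊎ u w)

  Empty : State M → Set
  Empty s = ∀ w → ¬ s w

  NonEmpty : State M → Set
  NonEmpty s = ∃ λ w → s w

  _⊆ˢ_ : State M → State M → Set
  t ⊆ˢ s = ∀ w → t w → s w

  Succ : W M → State M
  Succ w v = R M w v

  mutual
    _⊨_ : State M → Fm → Set₁
    s ⊨ var p    = Lift (lsuc 0ℓ) (∀ w → s w → V M p w)
    s ⊨ (¬ᶠ φ)   = s ⫤ φ
    s ⊨ (φ ∧ᶠ ψ) = (s ⊨ φ) × (s ⊨ ψ)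
    s ⊨ (φ ∨ᶠ ψ) = Σ (State M) λ t → Σ (State M) λ u →
                     IsUnion s t u × (t ⊨ φ) × (u ⊨ ψ)
    s ⊨ (◇ φ)    = ∀ w → s w → Σ (State M) λ t →
                     (t ⊆ˢ Succ w) × NonEmpty t × (t ⊨ φ)
    s ⊨ NE       = Lift (lsuc 0ℓ) (NonEmpty s)
    s ⊨ (⊘ φ)    = (s ⊨ φ) ⊎ Lift (lsuc 0ℓ) (Empty s)

    _⫤_ : State M → Fm → Set₁
    s ⫤ var p    = Lift (lsuc 0ℓ) (∀ w → s w → ¬ V M p w)
    s ⫤ (¬ᶠ φ)   = s ⊨ φ
    s ⫤ (φ ∧ᶠ ψ) = Σ (State M) λ t → Σ (State M) λ u →
                     IsUnion s t u × (t ⫤ φ) × (u ⫤ ψ)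
    s ⫤ (φ ∨ᶠ ψ) = (s ⫤ φ) × (s ⫤ ψ)
    s ⫤ (◇ φ)    = ∀ w → s w → Succ w ⫤ φ
    s ⫤ NE       = Lift (lsuc 0ℓ) (Empty s)
    s ⫤ (⊘ φ)    = s ⫤ φ

_⊨ˢ_ : (Fm → Set) → Fm → Set₁
Φ ⊨ˢ ψ = (M : Model) (s : State M) →
         (∀ φ → Φ φ → _⊨_ M s φ) → _⊨_ M s ψ

-- ML formulas are flat, and on a
-- singleton state they are bivalent (classically); hence every state splits
-- into a part supporting α and a part anti-supporting α, which is what makes
-- ¬I sound: the supporting part supports ⊥ and is therefore empty.  The ⊘
-- rules are sound because a ⊘ in distributive position is evaluated on a
-- state fixed by the context, where ⊘ψ holds by ψ or by emptiness (i.e. ⊥).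
module Submission where

open import Defs
open import Level using (Lift; lift; lower; 0ℓ) renaming (suc to lsuc)
open import Axiom.ExcludedMiddle using (ExcludedMiddle)
open import Data.Empty using (⊥; ⊥-elim)
open import Data.Unit using (⊤; tt)
open import Data.Product using (Σ; _×_; _,_; proj₁; proj₂)
open import Data.Sum as Sum using (_⊎_; inj₁; inj₂; [_,_])
open import Data.List using ([]; _∷_)
open import Data.List.Relation.Unary.All using (All; []; _∷_; tabulate; lookup)
open import Data.List.Relation.Unary.All.Properties using (++⁻)
open import Relation.Nullary using (¬_; yes; no)
open import Relation.Unary using (_⊆_; _≐_; ∅; ｛_｝; _∪_; _∩_)
open import Relation.Binary.PropositionalEquality using (refl)
open import Function using (id)
open import Function.Bundles using (mk⇔; Equivalence)

ML⇒NEfree : ∀ {α} → ML α → NEfree α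
ML⇒NEfree (var n)   = tt
ML⇒NEfree (neg m)   = ML⇒NEfree m
ML⇒NEfree (and m n) = ML⇒NEfree m , ML⇒NEfree n
ML⇒NEfree (or m n)  = ML⇒NEfree m , ML⇒NEfree n
ML⇒NEfree (dia m)   = ML⇒NEfree m

module TeamSemantics (M : Model) where

  infix 4 _⊩_ _⫣_

  _⊩_ : State M → Fm → Set₁
  _⊩_ = _⊨_ M

  _⫣_ : State M → Fm → Set₁
  _⫣_ = _⫤_ M

  module _ {s t u : State M} (s=t∪u : IsUnion M s t u) where

    IsUnion-⊆ : s ⊆ t ∪ u
    IsUnion-⊆ = Equivalence.to (s=t∪u _)

    IsUnion-⊇ˡ : t ⊆ s
    IsUnion-⊇ˡ x = Equivalence.from (s=t∪u _) (inj₁ x)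

    IsUnion-⊇ʳ : u ⊆ s
    IsUnion-⊇ʳ x = Equivalence.from (s=t∪u _) (inj₂ x)

  isUnion : ∀ {s t u : State M} → s ⊆ t ∪ u → t ⊆ s → u ⊆ s → IsUnion M s t u
  isUnion s⊆t∪u t⊆s u⊆s w = mk⇔ s⊆t∪u [ t⊆s , u⊆s ]

  IsUnion-∪ : ∀ {t u : State M} → IsUnion M (t ∪ u) t u
  IsUnion-∪ w = mk⇔ id id

  IsUnion-idem : ∀ {s : State M} → IsUnion M s s s
  IsUnion-idem = isUnion inj₁ id id

  IsUnion-∅ʳ : ∀ {s : State M} → IsUnion M s s ∅
  IsUnion-∅ʳ = isUnion inj₁ id λ ()

  IsUnion-∅ˡ : ∀ {s : State M} → IsUnion M s ∅ s
  IsUnion-∅ˡ = isUnion inj₂ (λ ()) id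

  IsUnion-comm : ∀ {s t u : State M} → IsUnion M s t u → IsUnion M s u t
  IsUnion-comm s=t∪u =
    isUnion (λ x → Sum.swap (IsUnion-⊆ s=t∪u x)) (IsUnion-⊇ʳ s=t∪u) (IsUnion-⊇ˡ s=t∪u)

  IsUnion-resp-≐ : ∀ {s s′ t u : State M} → s ≐ s′ → IsUnion M s t u → IsUnion M s′ t u
  IsUnion-resp-≐ (s⊆s′ , s′⊆s) s=t∪u =
    isUnion (λ x → IsUnion-⊆ s=t∪u (s′⊆s x))
            (λ x → s⊆s′ (IsUnion-⊇ˡ s=t∪u x)) (λ x → s⊆s′ (IsUnion-⊇ʳ s=t∪u x))

  IsUnion-restrict : ∀ {s s′ t u : State M} → s′ ⊆ s → IsUnion M s t u →
                     IsUnion M s′ (t ∩ s′) (u ∩ s′)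
  IsUnion-restrict s′⊆s s=t∪u =
    isUnion (λ x → Sum.map (_, x) (_, x) (IsUnion-⊆ s=t∪u (s′⊆s x))) proj₂ proj₂

  IsUnion-merge : ∀ {s t u t₁ t₂ u₁ u₂ : State M} →
                  IsUnion M s t u → IsUnion M t t₁ t₂ → IsUnion M u u₁ u₂ →
                  IsUnion M s (t₁ ∪ u₁) (t₂ ∪ u₂)
  IsUnion-merge s=t∪u t=t₁∪t₂ u=u₁∪u₂ = isUnion
    (λ x → [ (λ y → Sum.map inj₁ inj₁ (IsUnion-⊆ t=t₁∪t₂ y))
           , (λ y → Sum.map inj₂ inj₂ (IsUnion-⊆ u=u₁∪u₂ y)) ] (IsUnion-⊆ s=t∪u x))
    [ (λ y → IsUnion-⊇ˡ s=t∪u (IsUnion-⊇ˡ t=t₁∪t₂ y)) , (λ y → IsUnion-⊇ʳ s=t∪u (IsUnion-⊇ˡ u=u₁∪u₂ y)) ]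
    [ (λ y → IsUnion-⊇ˡ s=t∪u (IsUnion-⊇ʳ t=t₁∪t₂ y)) , (λ y → IsUnion-⊇ʳ s=t∪u (IsUnion-⊇ʳ u=u₁∪u₂ y)) ]

  IsUnion-Emptyˡ : ∀ {s t u : State M} → IsUnion M s t u → Empty M t → u ≐ s
  IsUnion-Emptyˡ s=t∪u t-empty =
    IsUnion-⊇ʳ s=t∪u , λ x → [ (λ y → ⊥-elim (t-empty _ y)) , id ] (IsUnion-⊆ s=t∪u x)

  -- The two parts are carved out of s by the side of the disjunction chosen
  -- at each point, which keeps them in Set although A and B live in Set₁.
  splitBy : ∀ {s : State M} {A B : W M → Set₁} → (∀ {w} → s w → A w ⊎ B w) →
            Σ (State M) λ t → Σ (State M) λ u →
              IsUnion M s t u × (∀ {w} → t w → A w) × (∀ {w} → u w → B w)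
  splitBy {s} {A} {B} choose =
    left , right , isUnion side proj₁ proj₁ , fromLeft , fromRight
    where
      IsInj₁ IsInj₂ : ∀ {w} → A w ⊎ B w → Set
      IsInj₁ (inj₁ _) = ⊤
      IsInj₁ (inj₂ _) = ⊥
      IsInj₂ (inj₁ _) = ⊥
      IsInj₂ (inj₂ _) = ⊤

      left right : State M
      left w  = Σ (s w) λ x → IsInj₁ (choose x)
      right w = Σ (s w) λ x → IsInj₂ (choose x)

      cover : ∀ {w} (c : A w ⊎ B w) → IsInj₁ c ⊎ IsInj₂ c
      cover (inj₁ _) = inj₁ tt
      cover (inj₂ _) = inj₂ tt

      side : s ⊆ left ∪ right
      side x = Sum.map (x ,_) (x ,_) (cover (choose x))

      fromLeft : left ⊆ A
      fromLeft (x , l) with choose x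
      ... | inj₁ a = a

      fromRight : right ⊆ B
      fromRight (x , r) with choose x
      ... | inj₂ b = b

  mutual
    ⊩-resp-≐ : ∀ {s s′} φ → s ≐ s′ → s ⊩ φ → s′ ⊩ φ
    ⊩-resp-≐ (var p)  (_ , s′⊆s) (lift h) = lift λ w x → h w (s′⊆s x)
    ⊩-resp-≐ (¬ᶠ φ)   s≐s′ h = ⫣-resp-≐ φ s≐s′ h
    ⊩-resp-≐ (φ ∧ᶠ ψ) s≐s′ (hφ , hψ) = ⊩-resp-≐ φ s≐s′ hφ , ⊩-resp-≐ ψ s≐s′ hψ
    ⊩-resp-≐ (φ ∨ᶠ ψ) s≐s′ (t , u , s=t∪u , hφ , hψ) = t , u , IsUnion-resp-≐ s≐s′ s=t∪u , hφ , hψ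
    ⊩-resp-≐ (◇ φ)    (_ , s′⊆s) h = λ w x → h w (s′⊆s x)
    ⊩-resp-≐ NE       (s⊆s′ , _) (lift (w , x)) = lift (w , s⊆s′ x)
    ⊩-resp-≐ (⊘ φ)    s≐s′ (inj₁ h) = inj₁ (⊩-resp-≐ φ s≐s′ h)
    ⊩-resp-≐ (⊘ φ)    (_ , s′⊆s) (inj₂ (lift e)) = inj₂ (lift λ w x → e w (s′⊆s x))

    ⫣-resp-≐ : ∀ {s s′} φ → s ≐ s′ → s ⫣ φ → s′ ⫣ φ
    ⫣-resp-≐ (var p)  (_ , s′⊆s) (lift h) = lift λ w x → h w (s′⊆s x)
    ⫣-resp-≐ (¬ᶠ φ)   s≐s′ h = ⊩-resp-≐ φ s≐s′ h
    ⫣-resp-≐ (φ ∧ᶠ ψ) s≐s′ (t , u , s=t∪u , hφ , hψ) = t , u , IsUnion-resp-≐ s≐s′ s=t∪u , hφ , hψ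
    ⫣-resp-≐ (φ ∨ᶠ ψ) s≐s′ (hφ , hψ) = ⫣-resp-≐ φ s≐s′ hφ , ⫣-resp-≐ ψ s≐s′ hψ
    ⫣-resp-≐ (◇ φ)    (_ , s′⊆s) h = λ w x → h w (s′⊆s x)
    ⫣-resp-≐ NE       (_ , s′⊆s) (lift e) = lift λ w x → e w (s′⊆s x)
    ⫣-resp-≐ (⊘ φ)    s≐s′ h = ⫣-resp-≐ φ s≐s′ h

  mutual
    ⊩-downClosed : ∀ {s s′} φ → NEfree φ → s′ ⊆ s → s ⊩ φ → s′ ⊩ φ
    ⊩-downClosed (var p)  _ s′⊆s (lift h) = lift λ w x → h w (s′⊆s x)
    ⊩-downClosed (¬ᶠ φ)   nf s′⊆s h = ⫣-downClosed φ nf s′⊆s h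
    ⊩-downClosed (φ ∧ᶠ ψ) (nφ , nψ) s′⊆s (hφ , hψ) =
      ⊩-downClosed φ nφ s′⊆s hφ , ⊩-downClosed ψ nψ s′⊆s hψ
    ⊩-downClosed (φ ∨ᶠ ψ) (nφ , nψ) s′⊆s (_ , _ , s=t∪u , hφ , hψ) =
      _ , _ , IsUnion-restrict s′⊆s s=t∪u , ⊩-downClosed φ nφ proj₁ hφ , ⊩-downClosed ψ nψ proj₁ hψ
    ⊩-downClosed (◇ φ)    _ s′⊆s h = λ w x → h w (s′⊆s x)
    ⊩-downClosed (⊘ φ)    nf s′⊆s (inj₁ h) = inj₁ (⊩-downClosed φ nf s′⊆s h)
    ⊩-downClosed (⊘ φ)    _ s′⊆s (inj₂ (lift e)) = inj₂ (lift λ w x → e w (s′⊆s x))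

    ⫣-downClosed : ∀ {s s′} φ → NEfree φ → s′ ⊆ s → s ⫣ φ → s′ ⫣ φ
    ⫣-downClosed (var p)  _ s′⊆s (lift h) = lift λ w x → h w (s′⊆s x)
    ⫣-downClosed (¬ᶠ φ)   nf s′⊆s h = ⊩-downClosed φ nf s′⊆s h
    ⫣-downClosed (φ ∧ᶠ ψ) (nφ , nψ) s′⊆s (_ , _ , s=t∪u , hφ , hψ) =
      _ , _ , IsUnion-restrict s′⊆s s=t∪u , ⫣-downClosed φ nφ proj₁ hφ , ⫣-downClosed ψ nψ proj₁ hψ
    ⫣-downClosed (φ ∨ᶠ ψ) (nφ , nψ) s′⊆s (hφ , hψ) =
      ⫣-downClosed φ nφ s′⊆s hφ , ⫣-downClosed ψ nψ s′⊆s hψ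
    ⫣-downClosed (◇ φ)    _ s′⊆s h = λ w x → h w (s′⊆s x)
    ⫣-downClosed (⊘ φ)    nf s′⊆s h = ⫣-downClosed φ nf s′⊆s h

  All-downClosed : ∀ {Γ s s′} → All NEfree Γ → s′ ⊆ s → All (s ⊩_) Γ → All (s′ ⊩_) Γ
  All-downClosed [] _ [] = []
  All-downClosed {φ ∷ _} (nf ∷ nfs) s′⊆s (h ∷ hs) = ⊩-downClosed φ nf s′⊆s h ∷ All-downClosed nfs s′⊆s hs

  mutual
    ⊩-empty : ∀ {s} φ → NEfree φ → Empty M s → s ⊩ φ
    ⊩-empty (var p)  _ e = lift λ w x → ⊥-elim (e w x)
    ⊩-empty (¬ᶠ φ)   nf e = ⫣-empty φ nf e
    ⊩-empty (φ ∧ᶠ ψ) (nφ , nψ) e = ⊩-empty φ nφ e , ⊩-empty ψ nψ e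
    ⊩-empty (φ ∨ᶠ ψ) (nφ , nψ) e = _ , _ , IsUnion-idem , ⊩-empty φ nφ e , ⊩-empty ψ nψ e
    ⊩-empty (◇ φ)    _ e = λ w x → ⊥-elim (e w x)
    ⊩-empty (⊘ φ)    _ e = inj₂ (lift e)

    ⫣-empty : ∀ {s} φ → NEfree φ → Empty M s → s ⫣ φ
    ⫣-empty (var p)  _ e = lift λ w x → ⊥-elim (e w x)
    ⫣-empty (¬ᶠ φ)   nf e = ⊩-empty φ nf e
    ⫣-empty (φ ∧ᶠ ψ) (nφ , nψ) e = _ , _ , IsUnion-idem , ⫣-empty φ nφ e , ⫣-empty ψ nψ e
    ⫣-empty (φ ∨ᶠ ψ) (nφ , nψ) e = ⫣-empty φ nφ e , ⫣-empty ψ nψ e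
    ⫣-empty (◇ φ)    _ e = λ w x → ⊥-elim (e w x)
    ⫣-empty (⊘ φ)    nf e = ⫣-empty φ nf e

  mutual
    ⊩-unionClosed : ∀ {s t u} φ → IsUnion M s t u → t ⊩ φ → u ⊩ φ → s ⊩ φ
    ⊩-unionClosed (var p)  s=t∪u (lift ht) (lift hu) = lift λ w x → [ ht w , hu w ] (IsUnion-⊆ s=t∪u x)
    ⊩-unionClosed (¬ᶠ φ)   s=t∪u ht hu = ⫣-unionClosed φ s=t∪u ht hu
    ⊩-unionClosed (φ ∧ᶠ ψ) s=t∪u (htφ , htψ) (huφ , huψ) =
      ⊩-unionClosed φ s=t∪u htφ huφ , ⊩-unionClosed ψ s=t∪u htψ huψ
    ⊩-unionClosed (φ ∨ᶠ ψ) s=t∪u (_ , _ , t=t₁∪t₂ , htφ , htψ) (_ , _ , u=u₁∪u₂ , huφ , huψ) =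
      _ , _ , IsUnion-merge s=t∪u t=t₁∪t₂ u=u₁∪u₂ ,
      ⊩-unionClosed φ IsUnion-∪ htφ huφ , ⊩-unionClosed ψ IsUnion-∪ htψ huψ
    ⊩-unionClosed (◇ φ)    s=t∪u ht hu = λ w x → [ ht w , hu w ] (IsUnion-⊆ s=t∪u x)
    ⊩-unionClosed NE       s=t∪u (lift (w , x)) _ = lift (w , IsUnion-⊇ˡ s=t∪u x)
    ⊩-unionClosed (⊘ φ)    s=t∪u (inj₁ ht) (inj₁ hu) = inj₁ (⊩-unionClosed φ s=t∪u ht hu)
    ⊩-unionClosed (⊘ φ)    s=t∪u (inj₂ (lift e)) hu =
      ⊩-resp-≐ (⊘ φ) (IsUnion-Emptyˡ s=t∪u e) hu
    ⊩-unionClosed (⊘ φ)    s=t∪u ht (inj₂ (lift e)) =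
      ⊩-resp-≐ (⊘ φ) (IsUnion-Emptyˡ (IsUnion-comm s=t∪u) e) ht

    ⫣-unionClosed : ∀ {s t u} φ → IsUnion M s t u → t ⫣ φ → u ⫣ φ → s ⫣ φ
    ⫣-unionClosed (var p)  s=t∪u (lift ht) (lift hu) = lift λ w x → [ ht w , hu w ] (IsUnion-⊆ s=t∪u x)
    ⫣-unionClosed (¬ᶠ φ)   s=t∪u ht hu = ⊩-unionClosed φ s=t∪u ht hu
    ⫣-unionClosed (φ ∧ᶠ ψ) s=t∪u (_ , _ , t=t₁∪t₂ , htφ , htψ) (_ , _ , u=u₁∪u₂ , huφ , huψ) =
      _ , _ , IsUnion-merge s=t∪u t=t₁∪t₂ u=u₁∪u₂ ,
      ⫣-unionClosed φ IsUnion-∪ htφ huφ , ⫣-unionClosed ψ IsUnion-∪ htψ huψ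
    ⫣-unionClosed (φ ∨ᶠ ψ) s=t∪u (htφ , htψ) (huφ , huψ) =
      ⫣-unionClosed φ s=t∪u htφ huφ , ⫣-unionClosed ψ s=t∪u htψ huψ
    ⫣-unionClosed (◇ φ)    s=t∪u ht hu = λ w x → [ ht w , hu w ] (IsUnion-⊆ s=t∪u x)
    ⫣-unionClosed NE       s=t∪u (lift et) (lift eu) = lift λ w x → [ et w , eu w ] (IsUnion-⊆ s=t∪u x)
    ⫣-unionClosed (⊘ φ)    s=t∪u ht hu = ⫣-unionClosed φ s=t∪u ht hu

  ⊩×⫣⇒Empty : ∀ {s} φ → NEfree φ → s ⊩ φ → s ⫣ φ → Empty M s
  ⊩×⫣⇒Empty (var p)  _ (lift h⊩) (lift h⫣) w x = h⫣ w x (h⊩ w x)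
  ⊩×⫣⇒Empty (¬ᶠ φ)   nf h⊩ h⫣ = ⊩×⫣⇒Empty φ nf h⫣ h⊩
  ⊩×⫣⇒Empty (φ ∧ᶠ ψ) (nφ , nψ) (hφ , hψ) (t , u , s=t∪u , tφ , uψ) w x =
    [ ⊩×⫣⇒Empty φ nφ (⊩-downClosed φ nφ (IsUnion-⊇ˡ s=t∪u) hφ) tφ w
    , ⊩×⫣⇒Empty ψ nψ (⊩-downClosed ψ nψ (IsUnion-⊇ʳ s=t∪u) hψ) uψ w ] (IsUnion-⊆ s=t∪u x)
  ⊩×⫣⇒Empty (φ ∨ᶠ ψ) (nφ , nψ) (t , u , s=t∪u , tφ , uψ) (hφ , hψ) w x =
    [ ⊩×⫣⇒Empty φ nφ tφ (⫣-downClosed φ nφ (IsUnion-⊇ˡ s=t∪u) hφ) w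
    , ⊩×⫣⇒Empty ψ nψ uψ (⫣-downClosed ψ nψ (IsUnion-⊇ʳ s=t∪u) hψ) w ] (IsUnion-⊆ s=t∪u x)
  ⊩×⫣⇒Empty (◇ φ)    nf h⊩ h⫣ w x with h⊩ w x
  ... | t , t⊆Rw , (v , y) , tφ = ⊩×⫣⇒Empty φ nf tφ (⫣-downClosed φ nf (t⊆Rw _) (h⫣ w x)) v y
  ⊩×⫣⇒Empty (⊘ φ)    nf (inj₁ h⊩) h⫣ = ⊩×⫣⇒Empty φ nf h⊩ h⫣
  ⊩×⫣⇒Empty (⊘ φ)    _ (inj₂ (lift e)) _ = e

  ⊩⊥ᶠ⇒Empty : ∀ {s} → s ⊩ ⊥ᶠ → Empty M s
  ⊩⊥ᶠ⇒Empty (h⊩p , h⫣p) = ⊩×⫣⇒Empty (var 0) tt h⊩p h⫣p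

  ∈⇒｛｝⊆ : ∀ {t : State M} {w} → t w → ｛ w ｝ ⊆ t
  ∈⇒｛｝⊆ x refl = x

  singleton-⊩∨ : ∀ {w} φ ψ → NEfree φ → NEfree ψ → ｛ w ｝ ⊩ φ ∨ᶠ ψ → ｛ w ｝ ⊩ φ ⊎ ｛ w ｝ ⊩ ψ
  singleton-⊩∨ φ ψ nφ nψ (_ , _ , w=t∪u , tφ , uψ) =
    Sum.map (λ y → ⊩-downClosed φ nφ (∈⇒｛｝⊆ y) tφ) (λ y → ⊩-downClosed ψ nψ (∈⇒｛｝⊆ y) uψ)
            (IsUnion-⊆ w=t∪u refl)

  singleton-⫣∧ : ∀ {w} φ ψ → NEfree φ → NEfree ψ → ｛ w ｝ ⫣ φ ∧ᶠ ψ → ｛ w ｝ ⫣ φ ⊎ ｛ w ｝ ⫣ ψ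
  singleton-⫣∧ φ ψ nφ nψ (_ , _ , w=t∪u , tφ , uψ) =
    Sum.map (λ y → ⫣-downClosed φ nφ (∈⇒｛｝⊆ y) tφ) (λ y → ⫣-downClosed ψ nψ (∈⇒｛｝⊆ y) uψ)
            (IsUnion-⊆ w=t∪u refl)

  mutual
    ⊩-flat : ∀ {s α} → ML α → (∀ {w} → s w → ｛ w ｝ ⊩ α) → s ⊩ α
    ⊩-flat (var p)   h = lift λ w x → lower (h x) w refl
    ⊩-flat (neg m)   h = ⫣-flat m h
    ⊩-flat (and m n) h = ⊩-flat m (λ x → proj₁ (h x)) , ⊩-flat n (λ x → proj₂ (h x))
    ⊩-flat {α = φ ∨ᶠ ψ} (or m n) h
      with splitBy (λ x → singleton-⊩∨ φ ψ (ML⇒NEfree m) (ML⇒NEfree n) (h x))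
    ... | t , u , s=t∪u , tφ , uψ = t , u , s=t∪u , ⊩-flat m tφ , ⊩-flat n uψ
    ⊩-flat (dia m)   h = λ w x → h x w refl

    ⫣-flat : ∀ {s α} → ML α → (∀ {w} → s w → ｛ w ｝ ⫣ α) → s ⫣ α
    ⫣-flat (var p)   h = lift λ w x → lower (h x) w refl
    ⫣-flat (neg m)   h = ⊩-flat m h
    ⫣-flat {α = φ ∧ᶠ ψ} (and m n) h
      with splitBy (λ x → singleton-⫣∧ φ ψ (ML⇒NEfree m) (ML⇒NEfree n) (h x))
    ... | t , u , s=t∪u , tφ , uψ = t , u , s=t∪u , ⫣-flat m tφ , ⫣-flat n uψ
    ⫣-flat (or m n)  h = ⫣-flat m (λ x → proj₁ (h x)) , ⫣-flat n (λ x → proj₂ (h x))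
    ⫣-flat (dia m)   h = λ w x → h x w refl

  ⊩-plug⊘ : ∀ {s} C ψ → s ⊩ plug C (⊘ ψ) → s ⊩ plug C ψ ⊎ s ⊩ plug C ⊥ᶠ
  ⊩-plug⊘ hole     ψ (inj₁ h)        = inj₁ h
  ⊩-plug⊘ hole     ψ (inj₂ (lift e)) = inj₂ (⊩-empty ⊥ᶠ (tt , tt) e)
  ⊩-plug⊘ (C ∧ₗ θ) ψ (h , hθ) = Sum.map (_, hθ) (_, hθ) (⊩-plug⊘ C ψ h)
  ⊩-plug⊘ (θ ∧ᵣ C) ψ (hθ , h) = Sum.map (hθ ,_) (hθ ,_) (⊩-plug⊘ C ψ h)
  ⊩-plug⊘ (C ∨ₗ θ) ψ (t , u , s=t∪u , h , hθ) =
    Sum.map (λ h′ → t , u , s=t∪u , h′ , hθ) (λ h′ → t , u , s=t∪u , h′ , hθ) (⊩-plug⊘ C ψ h)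
  ⊩-plug⊘ (θ ∨ᵣ C) ψ (t , u , s=t∪u , hθ , h) =
    Sum.map (λ h′ → t , u , s=t∪u , hθ , h′) (λ h′ → t , u , s=t∪u , hθ , h′) (⊩-plug⊘ C ψ h)
  ⊩-plug⊘ (⊘c C)   ψ (inj₁ h) = Sum.map inj₁ inj₁ (⊩-plug⊘ C ψ h)
  ⊩-plug⊘ (⊘c C)   ψ (inj₂ e) = inj₁ (inj₂ e)

  ⊩-◇plug⊘ : ∀ {s} C ψ → s ⊩ ◇ plug C (⊘ ψ) → s ⊩ ◇ plug C ψ ∨ᶠ ◇ plug C ⊥ᶠ
  ⊩-◇plug⊘ C ψ h with splitBy (λ {w} x → let t , t⊆Rw , ne , th = h w x in
                       Sum.map (λ th′ → t , t⊆Rw , ne , th′) (λ th′ → t , t⊆Rw , ne , th′)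
                               (⊩-plug⊘ C ψ th))
  ... | t , u , s=t∪u , tψ , u⊥ = t , u , s=t∪u , (λ w → tψ) , (λ w → u⊥)

  ⊩-□plug⊘ : ∀ {s} C ψ → s ⊩ □ plug C (⊘ ψ) → s ⊩ □ plug C ψ ∨ᶠ □ plug C ⊥ᶠ
  ⊩-□plug⊘ C ψ h with splitBy (λ {w} x → ⊩-plug⊘ C ψ (h w x))
  ... | t , u , s=t∪u , tψ , u⊥ = t , u , s=t∪u , (λ w → tψ) , (λ w → u⊥)

  ⊩-⊥ᶠ∨ : ∀ {s} φ → s ⊩ ⊥ᶠ ∨ᶠ φ → s ⊩ φ
  ⊩-⊥ᶠ∨ φ (_ , _ , s=t∪u , t⊥ , uφ) = ⊩-resp-≐ φ (IsUnion-Emptyˡ s=t∪u (⊩⊥ᶠ⇒Empty t⊥)) uφ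

  ⊮⊥⊥ : ∀ {s} → ¬ (s ⊩ ⊥⊥)
  ⊮⊥⊥ (s⊥ , lift (w , x)) = ⊩⊥ᶠ⇒Empty s⊥ w x

  ⊩-◇∨ : ∀ {s} φ ψ → s ⊩ ◇ φ → s ⊩ ◇ ψ → s ⊩ ◇ (φ ∨ᶠ ψ)
  ⊩-◇∨ φ ψ hφ hψ w x =
    let t , t⊆Rw , (v , y) , tφ = hφ w x
        u , u⊆Rw , _ , uψ = hψ w x
    in (t ∪ u) , (λ v → [ t⊆Rw v , u⊆Rw v ]) , (v , inj₁ y) , t , u , IsUnion-∪ , tφ , uψ

  ⊩-◇NE : ∀ {s} φ ψ → s ⊩ ◇ (φ ∨ᶠ (ψ ∧ᶠ NE)) → s ⊩ ◇ ψ
  ⊩-◇NE φ ψ h w x =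
    let _ , t⊆Rw , _ , (_ , u , t=t′∪u , _ , uψ , lift ne) = h w x in
    u , (λ v y → t⊆Rw v (IsUnion-⊇ʳ t=t′∪u y)) , ne , uψ

  ⊩-□NE : ∀ {s} φ → s ⊩ □ (φ ∧ᶠ NE) → s ⊩ ◇ φ
  ⊩-□NE φ h w x = let Rwφ , lift ne = h w x in Succ M w , (λ _ r → r) , ne , Rwφ

  ⊩-□◇∨ : ∀ {s} φ ψ → s ⊩ □ φ → s ⊩ ◇ ψ → s ⊩ □ (φ ∨ᶠ ψ)
  ⊩-□◇∨ φ ψ hφ hψ w x =
    let t , t⊆Rw , _ , tψ = hψ w x in Succ M w , t , isUnion inj₁ id (t⊆Rw _) , hφ w x , tψ

  module _ (em : ExcludedMiddle (lsuc 0ℓ)) where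

    singleton-bivalent : ∀ {α} → ML α → ∀ w → ｛ w ｝ ⊩ α ⊎ ｛ w ｝ ⫣ α
    singleton-bivalent (var p) w with em {Lift (lsuc 0ℓ) (V M p w)}
    ... | yes (lift v) = inj₁ (lift λ { _ refl → v })
    ... | no ¬v        = inj₂ (lift λ { _ refl v → ¬v (lift v) })
    singleton-bivalent (neg m) w = Sum.swap (singleton-bivalent m w)
    singleton-bivalent {φ ∧ᶠ ψ} (and m n) w with singleton-bivalent m w | singleton-bivalent n w
    ... | inj₁ hφ | inj₁ hψ = inj₁ (hφ , hψ)
    ... | inj₂ hφ | _       = inj₂ (_ , _ , IsUnion-∅ʳ , hφ , ⫣-empty ψ (ML⇒NEfree n) λ _ ())
    ... | inj₁ _  | inj₂ hψ = inj₂ (_ , _ , IsUnion-∅ˡ , ⫣-empty φ (ML⇒NEfree m) (λ _ ()) , hψ)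
    singleton-bivalent {φ ∨ᶠ ψ} (or m n) w with singleton-bivalent m w | singleton-bivalent n w
    ... | inj₂ hφ | inj₂ hψ = inj₂ (hφ , hψ)
    ... | inj₁ hφ | _       = inj₁ (_ , _ , IsUnion-∅ʳ , hφ , ⊩-empty ψ (ML⇒NEfree n) λ _ ())
    ... | inj₂ _  | inj₁ hψ = inj₁ (_ , _ , IsUnion-∅ˡ , ⊩-empty φ (ML⇒NEfree m) (λ _ ()) , hψ)
    singleton-bivalent {◇ φ} (dia m) w
      with em {Σ (State M) λ t → (∀ v → t v → R M w v) × NonEmpty M t × (t ⊩ φ)}
    ... | yes witness = inj₁ λ { _ refl → witness }
    ... | no ¬witness = inj₂ λ { _ refl → ⫣-flat m Rw⫣φ }
      where
        Rw⫣φ : ∀ {v} → R M w v → ｛ v ｝ ⫣ φ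
        Rw⫣φ {v} r = [ (λ vφ → ⊥-elim (¬witness (｛ v ｝ , (λ { _ refl → r }) , (v , refl) , vφ))) , id ]
                       (singleton-bivalent m v)

    bivalent-split : ∀ {α} → ML α → (s : State M) →
                     Σ (State M) λ t → Σ (State M) λ u → IsUnion M s t u × t ⊩ α × u ⫣ α
    bivalent-split m s with splitBy {s} (λ {w} _ → singleton-bivalent m w)
    ... | t , u , s=t∪u , tα , uα = t , u , s=t∪u , ⊩-flat m tα , ⫣-flat m uα

    ¬I-sound : ∀ {Γ α s} → ML α → All NEfree Γ →
               (∀ t → All (t ⊩_) (α ∷ Γ) → t ⊩ ⊥ᶠ) → All (s ⊩_) Γ → s ⫣ α
    ¬I-sound {α = α} {s} m nf ⊢⊥ hΓ with bivalent-split m s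
    ... | t , u , s=t∪u , tα , uα =
      ⫣-unionClosed α s=t∪u (⫣-empty α (ML⇒NEfree m) t-empty) uα
      where
        t-empty : Empty M t
        t-empty = ⊩⊥ᶠ⇒Empty (⊢⊥ t (tα ∷ All-downClosed nf (IsUnion-⊇ˡ s=t∪u) hΓ))

    ⊩-⊘NE : ∀ s → s ⊩ ⊘ NE
    ⊩-⊘NE s with em {Lift (lsuc 0ℓ) (NonEmpty M s)}
    ... | yes ne = inj₁ ne
    ... | no ¬ne = inj₂ (lift λ w x → ¬ne (lift (w , x)))

    mutual
      -- The rules for ¬ over ¬, ∧, ∨, ◇ and ⊘ are sound definitionally, since ¬
      -- merely swaps support and anti-support.
      soundness : ∀ {Γ φ} → Γ ⊢ φ → ∀ s → All (s ⊩_) Γ → s ⊩ φ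
      soundness ass            s (h ∷ []) = h
      soundness (weaken Γ⊆Δ d) s hΔ = soundness d s (tabulate λ φ∈Γ → lookup hΔ (Γ⊆Δ φ∈Γ))
      soundness (∧I {Γ} d e)   s h  = let hΓ , hΔ = ++⁻ Γ h in soundness d s hΓ , soundness e s hΔ
      soundness (∧E₁ d)        s h  = proj₁ (soundness d s h)
      soundness (∧E₂ d)        s h  = proj₂ (soundness d s h)
      soundness (¬I m nf d)    s h  = ¬I-sound m nf (λ t → soundness d t) h
      soundness (¬E {Γ} {α = α} {β} mα mβ d e) s h =
        let hΓ , hΔ = ++⁻ Γ h in
        ⊩-empty β (ML⇒NEfree mβ) (⊩×⫣⇒Empty α (ML⇒NEfree mα) (soundness d s hΓ) (soundness e s hΔ))
      soundness (¬¬E d)        s h  = soundness d s h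
      soundness (¬¬I d)        s h  = soundness d s h
      soundness (¬∧E d)        s h  = soundness d s h
      soundness (¬∧I d)        s h  = soundness d s h
      soundness (¬∨E d)        s h  = soundness d s h
      soundness (¬∨I d)        s h  = soundness d s h
      soundness (¬NEE d)       s h  = ⊩-empty ⊥ᶠ (tt , tt) (lower (soundness d s h))
      soundness (¬NEI d)       s h  = lift (⊩⊥ᶠ⇒Empty (soundness d s h))
      soundness (∨I {ψ = ψ} nf d) s h = _ , _ , IsUnion-∅ʳ , soundness d s h , ⊩-empty ψ nf λ _ ()
      soundness (∨dup d)       s h  = _ , _ , IsUnion-idem , soundness d s h , soundness d s h
      soundness (∨comm d)      s h  =
        let t , u , s=t∪u , tφ , uψ = soundness d s h in u , t , IsUnion-comm s=t∪u , uψ , tφ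
      soundness (∨E {Γ} {χ = χ} nf d e f) s h =
        let hΓ , hΔ = ++⁻ Γ h ; t , u , s=t∪u , tφ , uψ = soundness d s hΓ in
        ⊩-unionClosed χ s=t∪u (soundness e t (tφ ∷ All-downClosed nf (IsUnion-⊇ˡ s=t∪u) hΔ))
                              (soundness f u (uψ ∷ All-downClosed nf (IsUnion-⊇ʳ s=t∪u) hΔ))
      soundness (∨Mon {Γ} nf d e) s h =
        let hΓ , hΔ = ++⁻ Γ h ; t , u , s=t∪u , tφ , uψ = soundness d s hΓ in
        t , u , s=t∪u , tφ , soundness e u (uψ ∷ All-downClosed nf (IsUnion-⊇ʳ s=t∪u) hΔ)
      soundness (⊥∨E {φ = φ} d) s h = ⊩-⊥ᶠ∨ φ (soundness d s h)
      soundness (⊥⊥∨E d)       s h  = let _ , _ , _ , t⊥⊥ , _ = soundness d s h in ⊥-elim (⊮⊥⊥ t⊥⊥)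
      soundness (◇Mon d e)     s h w x =
        let t , t⊆Rw , ne , tφ = soundness e s h w x in t , t⊆Rw , ne , soundness d t (tφ ∷ [])
      soundness (□Mon Φs d ds) s h w x = soundness d (Succ M w) (soundness-□ ds s h x)
      soundness (¬◇E d)        s h  = soundness d s h
      soundness (¬◇I d)        s h  = soundness d s h
      soundness (◇NE {φ = φ} {ψ} d) s h = ⊩-◇NE φ ψ (soundness d s h)
      soundness (◇∨ {Γ} {φ = φ} {ψ} d e) s h =
        let hΓ , hΔ = ++⁻ Γ h in ⊩-◇∨ φ ψ (soundness d s hΓ) (soundness e s hΔ)
      soundness (□NE {φ = φ} d) s h = ⊩-□NE φ (soundness d s h)
      soundness (□◇∨ {Γ} {φ = φ} {ψ} d e) s h =
        let hΓ , hΔ = ++⁻ Γ h in ⊩-□◇∨ φ ψ (soundness d s hΓ) (soundness e s hΔ)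
      soundness ⊘NE            s h  = ⊩-⊘NE s
      soundness (⊥⊘ d)         s h  = inj₂ (lift (⊩⊥ᶠ⇒Empty (soundness d s h)))
      soundness (⊘I d)         s h  = inj₁ (soundness d s h)
      soundness (⊘E {Γ} C ψ d e f) s h =
        let hΓ , hΔ = ++⁻ Γ h in
        [ (λ hψ → soundness e s (hψ ∷ hΔ)) , (λ h⊥ → soundness f s (h⊥ ∷ hΔ)) ]
          (⊩-plug⊘ C ψ (soundness d s hΓ))
      soundness (¬⊘E d)        s h  = soundness d s h
      soundness (¬⊘I d)        s h  = soundness d s h
      soundness (◇⊘ C ψ d)     s h  = ⊩-◇plug⊘ C ψ (soundness d s h)
      soundness (□⊘ C ψ d)     s h  = ⊩-□plug⊘ C ψ (soundness d s h)

      soundness-□ : ∀ {Γ Φs} → All (λ φ → Γ ⊢ □ φ) Φs → ∀ s → All (s ⊩_) Γ →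
                    ∀ {w} → s w → All (Succ M w ⊩_) Φs
      soundness-□ []       s h x = []
      soundness-□ (d ∷ ds) s h x = soundness d s h _ x ∷ soundness-□ ds s h x

theorem4p25 : ExcludedMiddle (lsuc 0ℓ) →
              (Φ : Fm → Set) (ψ : Fm) → Φ ⊢ˢ ψ → Φ ⊨ˢ ψ
theorem4p25 em Φ ψ (Γ , Γ⊆Φ , d) M s s⊨Φ =
  TeamSemantics.soundness M em d s (tabulate λ {φ} φ∈Γ → s⊨Φ φ (Γ⊆Φ φ φ∈Γ))
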